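{- Let $G$ be a connected graph and let $(A,B)$ be a proper W-join of $G$. Let $G'$ be the graph obtained from $G$ by removing $A\cup B$ and adding new vertices $a,a',b,b'$, where $a$ and $a'$ are made adjacent to every vertex of $N(A)\setminus B$, $b$ and $b'$ are made adjacent to every vertex of $N(B)\setminus A$, and the edges $aa'$, $bb'$, $ab$ are added. Then $\gamma_c(G)=\gamma_c(G')$. Moreover, if $G$ is claw-free then $G'$ is claw-free.
   Context: For $S\subseteq V(G)$, $N(S)$ is the set of vertices outside $S$ adjacent to some vertex of $S$. A W-join of $G$ is a pair $(A,B)$ of disjoint cliques such that every vertex of $V(G)\setminus(A\cup B)$ is adjacent to all or none of $A$ and to all or none of $B$, $A$ is neither complete nor anticomplete to $B$, and $|A|\geq2$ or $|B|\geq2$. It is proper if no vertex of $A$ is adjacent to all or to none of $B$ and no vertex of $B$ is adjacent to all or to none of $A$. For a connected graph $H$, $\gamma_c(H)$ is the minimum size of a dominating set $D$ of $H$ with $H[D]$ connected. A graph is claw-free if it has no induced $K_{1,3}$. -}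

module Defs where

open import Data.Nat using (ℕ; _≤_; _≥_)
open import Data.Fin using (Fin)
open import Data.Fin.Subset using (Subset; ⊤; _∈_; _∉_; _∪_; ∣_∣)
open import Data.Bool using (Bool; true; false)
open import Data.Product using (Σ; ∃; _×_; _,_)
open import Data.Sum using (_⊎_)
open import Relation.Binary.PropositionalEquality using (_≡_; _≢_)
open import Relation.Nullary using (¬_)
open import Function.Bundles using (_⇔_)

record Graph (n : ℕ) : Set where
  field
    adj    : Fin n → Fin n → Bool
    sym    : ∀ u v → adj u v ≡ adj v u
    irrefl : ∀ v → adj v v ≡ false

open Graph public

E : ∀ {n} → Graph n → Fin n → Fin n → Set
E G u v = adj G u v ≡ true

data Walk {n} (G : Graph n) (S : Subset n) : Fin n → Fin n → Set where
  here : ∀ {u} → u ∈ S → Walk G S u u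
  step : ∀ {u w v} → u ∈ S → E G u w → Walk G S w v → Walk G S u v

ConnectedOn : ∀ {n} → Graph n → Subset n → Set
ConnectedOn G S = ∀ u v → u ∈ S → v ∈ S → Walk G S u v

Connected : ∀ {n} → Graph n → Set
Connected {n} G = Fin n × ConnectedOn G ⊤

Dominating : ∀ {n} → Graph n → Subset n → Set
Dominating G D = ∀ v → v ∈ D ⊎ Σ _ λ u → u ∈ D × E G u v

ConnDominating : ∀ {n} → Graph n → Subset n → Set
ConnDominating G D = Dominating G D × ConnectedOn G D

IsConnDomNumber : ∀ {n} → Graph n → ℕ → Set
IsConnDomNumber G k =
  (Σ _ λ D → ConnDominating G D × ∣ D ∣ ≡ k) ×
  (∀ D → ConnDominating G D → k ≤ ∣ D ∣)

Clique : ∀ {n} → Graph n → Subset n → Set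
Clique G A = ∀ u v → u ∈ A → v ∈ A → u ≢ v → E G u v

CompleteTo : ∀ {n} → Graph n → Fin n → Subset n → Set
CompleteTo G v A = ∀ u → u ∈ A → E G v u

AnticompleteTo : ∀ {n} → Graph n → Fin n → Subset n → Set
AnticompleteTo G v A = ∀ u → u ∈ A → ¬ E G v u

record WJoin {n} (G : Graph n) (A B : Subset n) : Set where
  field
    disjoint  : ∀ v → v ∈ A → v ∉ B
    cliqueA   : Clique G A
    cliqueB   : Clique G B
    homogA    : ∀ v → v ∉ A ∪ B → CompleteTo G v A ⊎ AnticompleteTo G v A
    homogB    : ∀ v → v ∉ A ∪ B → CompleteTo G v B ⊎ AnticompleteTo G v B
    notCompl  : ¬ (∀ u v → u ∈ A → v ∈ B → E G u v)
    notAnti   : ¬ (∀ u v → u ∈ A → v ∈ B → ¬ E G u v)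
    size      : ∣ A ∣ ≥ 2 ⊎ ∣ B ∣ ≥ 2

record ProperWJoin {n} (G : Graph n) (A B : Subset n) : Set where
  field
    wjoin  : WJoin G A B
    properA : ∀ u → u ∈ A → ¬ CompleteTo G u B × ¬ AnticompleteTo G u B
    properB : ∀ u → u ∈ B → ¬ CompleteTo G u A × ¬ AnticompleteTo G u A

-- This determines G' up to isomorphism.
record IsWJoinReduct {n m} (G : Graph n) (A B : Subset n) (G' : Graph m)
       (f : Fin n → Fin m) (a a' b b' : Fin m) : Set where
  field
    f-inj   : ∀ u v → u ∉ A ∪ B → v ∉ A ∪ B → f u ≡ f v → u ≡ v
    f-fresh : ∀ u → u ∉ A ∪ B → f u ≢ a × f u ≢ a' × f u ≢ b × f u ≢ b'
    new-distinct : a ≢ a' × a ≢ b × a ≢ b' × a' ≢ b × a' ≢ b' × b ≢ b'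
    covers  : ∀ w → (Σ _ λ u → u ∉ A ∪ B × f u ≡ w)
                    ⊎ w ≡ a ⊎ w ≡ a' ⊎ w ≡ b ⊎ w ≡ b'
    adj-old : ∀ u v → u ∉ A ∪ B → v ∉ A ∪ B → adj G' (f u) (f v) ≡ adj G u v
    -- for u ∉ A ∪ B: u ∈ N(A) ∖ B  iff  u has a neighbour in A
    adj-a   : ∀ u → u ∉ A ∪ B → E G' a  (f u) ⇔ (Σ _ λ x → x ∈ A × E G x u)
    adj-a'  : ∀ u → u ∉ A ∪ B → E G' a' (f u) ⇔ (Σ _ λ x → x ∈ A × E G x u)
    adj-b   : ∀ u → u ∉ A ∪ B → E G' b  (f u) ⇔ (Σ _ λ x → x ∈ B × E G x u)
    adj-b'  : ∀ u → u ∉ A ∪ B → E G' b' (f u) ⇔ (Σ _ λ x → x ∈ B × E G x u)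
    aa'     : E G' a a'
    bb'     : E G' b b'
    ab      : E G' a b
    ¬ab'    : ¬ E G' a b'
    ¬a'b    : ¬ E G' a' b
    ¬a'b'   : ¬ E G' a' b'

ClawFree : ∀ {n} → Graph n → Set
ClawFree G = ∀ c x y z → E G c x → E G c y → E G c z →
  x ≢ y → x ≢ z → y ≢ z →
  ¬ (¬ E G x y × ¬ E G x z × ¬ E G y z)

-- Two vertex maps carry connected dominating sets between G and G′ without making them larger.
-- Contracting A to a and B to b maps adjacent vertices of G to adjacent or equal ones, so the image
-- of a connected dominating set D of G is connected and dominates all of G′ except possibly a, a′
-- (or b, b′) when D misses N[A] ∖ B; then properness forces two vertices of D into B, both sent
-- to b, and a can be added for free.  Conversely, sending a, a′ to some x₀ ∈ A and b, b′ to an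
-- adjacent y₀ ∈ B turns every connected dominating set of G′ into one of G.  A claw of G′ contains
-- at most one of a, a′ (twins apart from the neighbour b of a) and at most one of b, b′, so the
-- same map, with x₀ y₀ adjacent exactly when the claw contains both a and b, embeds it into G as an
-- induced claw.

module Submission where

open import Defs hiding (sym)
open import Data.Nat using (ℕ; zero; suc; _≤_; _<_; _+_; z≤n; s≤s)
open import Data.Nat.Properties
  using (≤-trans; ≤-antisym; ≤-reflexive; +-suc; +-monoʳ-≤; +-comm; module ≤-Reasoning)
open import Data.Fin using (Fin; zero; suc)
open import Data.Fin.Properties using (any?; ¬∀⟶∃¬) renaming (_≟_ to _≟ᶠ_)
open import Data.Fin.Subset
  using (Subset; _∈_; _∉_; _⊆_; _∪_; _-_; ∣_∣; ⁅_⁆; inside; outside) renaming (⊥ to ∅)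
open import Data.Fin.Subset.Properties
  using (_∈?_; ∉⊥; x∈p∪q⁺; x∈p∪q⁻; ∪-comm; ∪-identityʳ; p⊆q⇒∣p∣≤∣q∣; ∣p∣≤∣x∷p∣; ∣⊥∣≡0; ∣⁅x⁆∣≡1;
         x∈⁅x⁆; x∈⁅y⁆⇒x≡y; x∈p∧x≢y⇒x∈p-y; x∈p⇒∣p-x∣<∣p∣)
open import Data.Vec.Base using ([]; _∷_; here; there)
open import Data.Product using (Σ; ∃; ∃₂; _×_; _,_; proj₁; proj₂)
open import Data.Sum using (_⊎_; inj₁; inj₂; map₂; swap)
open import Data.Empty using (⊥; ⊥-elim)
open import Data.Bool using (true)
open import Data.Bool.Properties using () renaming (_≟_ to _≟ᵇ_)
open import Relation.Nullary using (¬_; Dec; yes; no; does)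
open import Relation.Nullary.Decidable using (_×-dec_; _⊎-dec_; _→-dec_; ¬?)
open import Relation.Binary.PropositionalEquality using (_≡_; _≢_; refl; sym; trans; cong; subst)
open import Function using (_∘_)
open import Function.Bundles using (_⇔_; mk⇔; module Equivalence)
open Equivalence using (to; from)

subsetOf : ∀ {k} {P : Fin k → Set} → (∀ x → Dec (P x)) → Subset k
subsetOf {zero}  P? = []
subsetOf {suc k} P? = does (P? zero) ∷ subsetOf (P? ∘ suc)

∈-subsetOf⁺ : ∀ {k} {P : Fin k → Set} (P? : ∀ x → Dec (P x)) {x} → P x → x ∈ subsetOf P?
∈-subsetOf⁺ P? {zero} p with P? zero
... | yes _ = here
... | no ¬p = ⊥-elim (¬p p)
∈-subsetOf⁺ P? {suc x} p = there (∈-subsetOf⁺ (P? ∘ suc) p)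

∈-subsetOf⁻ : ∀ {k} {P : Fin k → Set} (P? : ∀ x → Dec (P x)) {x} → x ∈ subsetOf P? → P x
∈-subsetOf⁻ P? {zero} x∈ with P? zero | x∈
... | yes p | _ = p
... | no _  | ()
∈-subsetOf⁻ P? {suc x} (there x∈) = ∈-subsetOf⁻ (P? ∘ suc) x∈

img : ∀ {k l} → (Fin k → Fin l) → Subset k → Subset l
img h T = subsetOf λ w → any? λ u → (u ∈? T) ×-dec (h u ≟ᶠ w)

img⁺ : ∀ {k l} (h : Fin k → Fin l) {T u} → u ∈ T → h u ∈ img h T
img⁺ h {u = u} u∈T = ∈-subsetOf⁺ _ (u , u∈T , refl)

img⁻ : ∀ {k l} (h : Fin k → Fin l) {T w} → w ∈ img h T → ∃ λ u → u ∈ T × h u ≡ w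
img⁻ h = ∈-subsetOf⁻ _

∣p∪q∣≤∣p∣+∣q∣ : ∀ {k} (p q : Subset k) → ∣ p ∪ q ∣ ≤ ∣ p ∣ + ∣ q ∣
∣p∪q∣≤∣p∣+∣q∣ []            []            = z≤n
∣p∪q∣≤∣p∣+∣q∣ (inside  ∷ p) (s ∷ q)       =
  s≤s (≤-trans (∣p∪q∣≤∣p∣+∣q∣ p q) (+-monoʳ-≤ ∣ p ∣ (∣p∣≤∣x∷p∣ s q)))
∣p∪q∣≤∣p∣+∣q∣ (outside ∷ p) (outside ∷ q) = ∣p∪q∣≤∣p∣+∣q∣ p q
∣p∪q∣≤∣p∣+∣q∣ (outside ∷ p) (inside  ∷ q) =
  ≤-trans (s≤s (∣p∪q∣≤∣p∣+∣q∣ p q)) (≤-reflexive (sym (+-suc ∣ p ∣ ∣ q ∣)))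

∣img∣≤ : ∀ {k l} (h : Fin k → Fin l) T → ∣ img h T ∣ ≤ ∣ T ∣
∣img∣≤ {l = l} h [] = ≤-trans (p⊆q⇒∣p∣≤∣q∣ empty) (≤-reflexive (∣⊥∣≡0 l))
  where
  empty : img h [] ⊆ ∅
  empty w∈ with img⁻ h w∈
  ... | () , _
∣img∣≤ h (outside ∷ T) = ≤-trans (p⊆q⇒∣p∣≤∣q∣ shift) (∣img∣≤ (h ∘ suc) T)
  where
  shift : img h (outside ∷ T) ⊆ img (h ∘ suc) T
  shift w∈ with img⁻ h w∈
  ... | suc u , there u∈T , refl = img⁺ (h ∘ suc) u∈T
∣img∣≤ h (inside ∷ T) = begin
  ∣ img h (inside ∷ T) ∣                  ≤⟨ p⊆q⇒∣p∣≤∣q∣ split ⟩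
  ∣ ⁅ h zero ⁆ ∪ img (h ∘ suc) T ∣        ≤⟨ ∣p∪q∣≤∣p∣+∣q∣ ⁅ h zero ⁆ _ ⟩
  ∣ ⁅ h zero ⁆ ∣ + ∣ img (h ∘ suc) T ∣    ≡⟨ cong (_+ ∣ img (h ∘ suc) T ∣) (∣⁅x⁆∣≡1 (h zero)) ⟩
  suc ∣ img (h ∘ suc) T ∣                 ≤⟨ s≤s (∣img∣≤ (h ∘ suc) T) ⟩
  suc ∣ T ∣                               ∎
  where
  open ≤-Reasoning
  split : img h (inside ∷ T) ⊆ ⁅ h zero ⁆ ∪ img (h ∘ suc) T
  split w∈ with img⁻ h w∈
  ... | zero  , _         , refl = x∈p∪q⁺ (inj₁ (x∈⁅x⁆ (h zero)))
  ... | suc u , there u∈T , refl = x∈p∪q⁺ (inj₂ (img⁺ (h ∘ suc) u∈T))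

∣img∣< : ∀ {k l} (h : Fin k → Fin l) {T s y} → s ∈ T → y ∈ T → s ≢ y → h s ≡ h y →
         ∣ img h T ∣ < ∣ T ∣
∣img∣< h {T} {s} {y} s∈T y∈T s≢y hs≡hy = begin-strict
  ∣ img h T ∣        ≤⟨ p⊆q⇒∣p∣≤∣q∣ avoid-s ⟩
  ∣ img h (T - s) ∣  ≤⟨ ∣img∣≤ h (T - s) ⟩
  ∣ T - s ∣          <⟨ x∈p⇒∣p-x∣<∣p∣ s∈T ⟩
  ∣ T ∣              ∎
  where
  open ≤-Reasoning
  avoid-s : img h T ⊆ img h (T - s)
  avoid-s w∈ with img⁻ h w∈
  ... | u , u∈T , refl with u ≟ᶠ s
  ...   | yes refl = subst (_∈ img h (T - s)) (sym hs≡hy) (img⁺ h (x∈p∧x≢y⇒x∈p-y y∈T (s≢y ∘ sym)))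
  ...   | no u≢s   = img⁺ h (x∈p∧x≢y⇒x∈p-y u∈T u≢s)

∣img∪⁅⁆∣≤ : ∀ {k l} (h : Fin k → Fin l) (t : Fin l) {T s y} → s ∈ T → y ∈ T → s ≢ y → h s ≡ h y →
            ∣ img h T ∪ ⁅ t ⁆ ∣ ≤ ∣ T ∣
∣img∪⁅⁆∣≤ h t {T} s∈T y∈T s≢y hs≡hy = begin
  ∣ img h T ∪ ⁅ t ⁆ ∣      ≤⟨ ∣p∪q∣≤∣p∣+∣q∣ (img h T) ⁅ t ⁆ ⟩
  ∣ img h T ∣ + ∣ ⁅ t ⁆ ∣  ≡⟨ cong (∣ img h T ∣ +_) (∣⁅x⁆∣≡1 t) ⟩
  ∣ img h T ∣ + 1          ≡⟨ +-comm ∣ img h T ∣ 1 ⟩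
  suc ∣ img h T ∣          ≤⟨ ∣img∣< h s∈T y∈T s≢y hs≡hy ⟩
  ∣ T ∣                    ∎
  where open ≤-Reasoning

module _ {k} (H : Graph k) where

  E-sym : ∀ {u v} → E H u v → E H v u
  E-sym {u} {v} e = trans (Graph.sym H v u) e

  E-irrefl : ∀ {u} → ¬ E H u u
  E-irrefl {u} e with trans (sym e) (Graph.irrefl H u)
  ... | ()

  E? : ∀ u v → Dec (E H u v)
  E? u v = adj H u v ≟ᵇ true

  Near : Fin k → Fin k → Set
  Near u v = u ≡ v ⊎ E H u v

  Near-sym : ∀ {u v} → Near u v → Near v u
  Near-sym (inj₁ refl) = inj₁ refl
  Near-sym (inj₂ e)    = inj₂ (E-sym e)

  near? : ∀ u v → Dec (Near u v)
  near? u v = (u ≟ᶠ v) ⊎-dec E? u v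

  Dominated : Subset k → Fin k → Set
  Dominated S v = v ∈ S ⊎ Σ _ λ u → u ∈ S × E H u v

  dominated : ∀ {S u v} → u ∈ S → Near u v → Dominated S v
  dominated u∈S (inj₁ refl) = inj₁ u∈S
  dominated u∈S (inj₂ e)    = inj₂ (_ , u∈S , e)

  ¬near : ∀ {u v} → u ≢ v → ¬ E H u v → ¬ Near u v
  ¬near u≢v ¬u-v (inj₁ u≡v) = u≢v u≡v
  ¬near u≢v ¬u-v (inj₂ u-v) = ¬u-v u-v

  dominator : ∀ {S v} → Dominated S v → ∃ λ u → u ∈ S × Near u v
  dominator (inj₁ v∈S)           = _ , v∈S , inj₁ refl
  dominator (inj₂ (u , u∈S , e)) = u , u∈S , inj₂ e

  not-complete : ∀ {v X} → ¬ CompleteTo H v X → ∃ λ x → x ∈ X × ¬ E H v x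
  not-complete {v} {X} ¬complete with ¬∀⟶∃¬ k _ (λ x → x ∈? X →-dec E? v x) ¬complete
  ... | x , ¬[x∈X⇒v-x] with x ∈? X
  ...   | yes x∈X = x , x∈X , λ v-x → ¬[x∈X⇒v-x] λ _ → v-x
  ...   | no x∉X  = ⊥-elim (¬[x∈X⇒v-x] (⊥-elim ∘ x∉X))

  dominated-⊆ : ∀ {S S′ v} → S ⊆ S′ → Dominated S v → Dominated S′ v
  dominated-⊆ S⊆S′ (inj₁ v∈S)           = inj₁ (S⊆S′ v∈S)
  dominated-⊆ S⊆S′ (inj₂ (u , u∈S , e)) = inj₂ (u , S⊆S′ u∈S , e)

  clique-near : ∀ {A u v} → Clique H A → u ∈ A → v ∈ A → Near u v
  clique-near {u = u} {v} cl u∈A v∈A with u ≟ᶠ v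
  ... | yes u≡v = inj₁ u≡v
  ... | no u≢v  = inj₂ (cl u v u∈A v∈A u≢v)

  walk-snoc : ∀ {S u v w} → Walk H S u v → E H v w → w ∈ S → Walk H S u w
  walk-snoc (here u∈S)       e w∈S = step u∈S e (here w∈S)
  walk-snoc (step u∈S e′ W) e w∈S = step u∈S e′ (walk-snoc W e w∈S)

  walk-prepend : ∀ {S u v w} → u ∈ S → Near u v → Walk H S v w → Walk H S u w
  walk-prepend u∈S (inj₁ refl) W = W
  walk-prepend u∈S (inj₂ e)    W = step u∈S e W

  walk-append : ∀ {S u v w} → Walk H S u v → Near v w → w ∈ S → Walk H S u w
  walk-append W (inj₁ refl) w∈S = W
  walk-append W (inj₂ e)    w∈S = walk-snoc W e w∈S

WeakHom : ∀ {k l} → Graph k → Graph l → (Fin k → Fin l) → Set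
WeakHom H K h = ∀ {u v} → E H u v → Near K (h u) (h v)

module _ {k l} {H : Graph k} {K : Graph l} {h : Fin k → Fin l} (hom : WeakHom H K h) where

  walk-map : ∀ {S S′} → (∀ {u} → u ∈ S → h u ∈ S′) → ∀ {u v} → Walk H S u v → Walk K S′ (h u) (h v)
  walk-map h∈ (here u∈S)     = here (h∈ u∈S)
  walk-map h∈ (step u∈S e W) = walk-prepend K (h∈ u∈S) (hom e) (walk-map h∈ W)

  dominated-img : ∀ {S v} → Dominated H S v → Dominated K (img h S) (h v)
  dominated-img (inj₁ v∈S)           = inj₁ (img⁺ h v∈S)
  dominated-img (inj₂ (u , u∈S , e)) = dominated K (img⁺ h u∈S) (hom e)

  connectedOn-anchored : ∀ {D D′} → ConnectedOn H D → (∀ {u} → u ∈ D → h u ∈ D′) →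
    (∀ {w} → w ∈ D′ → ∃ λ u → u ∈ D × Near K (h u) w) → ConnectedOn K D′
  connectedOn-anchored conn h∈ anchor w₁ w₂ w₁∈ w₂∈
    with anchor w₁∈ | anchor w₂∈
  ... | u₁ , u₁∈D , n₁ | u₂ , u₂∈D , n₂ =
    walk-prepend K w₁∈ (Near-sym K n₁) (walk-append K (walk-map h∈ (conn u₁ u₂ u₁∈D u₂∈D)) n₂ w₂∈)

  connectedOn-img : ∀ {D} → ConnectedOn H D → ConnectedOn K (img h D)
  connectedOn-img conn = connectedOn-anchored conn (img⁺ h) anchor
    where
    anchor : ∀ {w} → w ∈ img h _ → ∃ λ u → u ∈ _ × Near K (h u) w
    anchor w∈ with img⁻ h w∈
    ... | u , u∈D , refl = u , u∈D , inj₁ refl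

ShrinksCDS : ∀ {k l} → Graph k → Graph l → Set
ShrinksCDS G H = ∀ D → ConnDominating G D → ∃ λ D′ → ConnDominating H D′ × ∣ D′ ∣ ≤ ∣ D ∣

isConnDomNumber-transfer : ∀ {k l} {G : Graph k} {H : Graph l} → ShrinksCDS G H → ShrinksCDS H G →
  ∀ {γ} → IsConnDomNumber G γ → IsConnDomNumber H γ
isConnDomNumber-transfer G→H H→G ((D , cds , refl) , minimal) with G→H D cds
... | D′ , cds′ , ∣D′∣≤∣D∣ = (D′ , cds′ , ≤-antisym ∣D′∣≤∣D∣ (lower D′ cds′)) , lower
  where
  lower : ∀ D₁ → ConnDominating _ D₁ → ∣ D ∣ ≤ ∣ D₁ ∣
  lower D₁ cds₁ with H→G D₁ cds₁
  ... | D₂ , cds₂ , ∣D₂∣≤∣D₁∣ = ≤-trans (minimal D₂ cds₂) ∣D₂∣≤∣D₁∣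

isConnDomNumber-⇔ : ∀ {k l} {G : Graph k} {H : Graph l} → ShrinksCDS G H → ShrinksCDS H G →
  ∀ γ → IsConnDomNumber G γ ⇔ IsConnDomNumber H γ
isConnDomNumber-⇔ G→H H→G γ = mk⇔ (isConnDomNumber-transfer G→H H→G) (isConnDomNumber-transfer H→G G→H)

record Claw {k} (H : Graph k) (c x y z : Fin k) : Set where
  field
    c-x : E H c x
    c-y : E H c y
    c-z : E H c z
    x≢y : x ≢ y
    x≢z : x ≢ z
    y≢z : y ≢ z
    ¬x-y : ¬ E H x y
    ¬x-z : ¬ E H x z
    ¬y-z : ¬ E H y z

Leaf : ∀ {k} → (x y z w : Fin k) → Set
Leaf x y z w = w ≡ x ⊎ w ≡ y ⊎ w ≡ z

InClaw : ∀ {k} → (c x y z w : Fin k) → Set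
InClaw c x y z w = w ≡ c ⊎ Leaf x y z w

InClaw? : ∀ {k} (c x y z w : Fin k) → Dec (InClaw c x y z w)
InClaw? c x y z w = (w ≟ᶠ c) ⊎-dec (w ≟ᶠ x) ⊎-dec (w ≟ᶠ y) ⊎-dec (w ≟ᶠ z)

module _ {k} {H : Graph k} {c x y z} (claw : Claw H c x y z) where
  open Claw claw

  center-leaf : ∀ {w} → Leaf x y z w → E H c w
  center-leaf (inj₁ refl)        = c-x
  center-leaf (inj₂ (inj₁ refl)) = c-y
  center-leaf (inj₂ (inj₂ refl)) = c-z

  leaf-leaf : ∀ {w w′} → Leaf x y z w → Leaf x y z w′ → ¬ E H w w′
  leaf-leaf (inj₁ refl)        (inj₁ refl)        = E-irrefl H
  leaf-leaf (inj₁ refl)        (inj₂ (inj₁ refl)) = ¬x-y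
  leaf-leaf (inj₁ refl)        (inj₂ (inj₂ refl)) = ¬x-z
  leaf-leaf (inj₂ (inj₁ refl)) (inj₁ refl)        = ¬x-y ∘ E-sym H
  leaf-leaf (inj₂ (inj₁ refl)) (inj₂ (inj₁ refl)) = E-irrefl H
  leaf-leaf (inj₂ (inj₁ refl)) (inj₂ (inj₂ refl)) = ¬y-z
  leaf-leaf (inj₂ (inj₂ refl)) (inj₁ refl)        = ¬x-z ∘ E-sym H
  leaf-leaf (inj₂ (inj₂ refl)) (inj₂ (inj₁ refl)) = ¬y-z ∘ E-sym H
  leaf-leaf (inj₂ (inj₂ refl)) (inj₂ (inj₂ refl)) = E-irrefl H

  other-leaves : ∀ {w} → Leaf x y z w →
    ∃₂ λ p q → Leaf x y z p × Leaf x y z q × p ≢ q × p ≢ w × q ≢ w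
  other-leaves (inj₁ refl) =
    y , z , inj₂ (inj₁ refl) , inj₂ (inj₂ refl) , y≢z , x≢y ∘ sym , x≢z ∘ sym
  other-leaves (inj₂ (inj₁ refl)) =
    x , z , inj₁ refl , inj₂ (inj₂ refl) , x≢z , x≢y , y≢z ∘ sym
  other-leaves (inj₂ (inj₂ refl)) =
    x , y , inj₁ refl , inj₂ (inj₁ refl) , x≢y , x≢z , y≢z

  -- v is a twin of u except for the extra neighbour t of u (as a′ of a, with t = b)
  claw-omits-twin : ∀ {u v t} → E H u v → (∀ {w} → E H v w → Near H u w) →
    (∀ {w} → E H u w → w ≢ v → ¬ E H v w → w ≡ t) →
    InClaw c x y z u → InClaw c x y z v → ⊥
  claw-omits-twin u-v N[v]⊆N[u] only-t (inj₁ refl) (inj₁ refl) = E-irrefl H u-v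
  claw-omits-twin u-v N[v]⊆N[u] only-t (inj₂ lu)   (inj₂ lv)   = leaf-leaf lu lv u-v
  claw-omits-twin u-v N[v]⊆N[u] only-t (inj₁ refl) (inj₂ lv) with other-leaves lv
  ... | p , q , lp , lq , p≢q , p≢v , q≢v =
    p≢q (trans (only-t (center-leaf lp) p≢v (leaf-leaf lv lp))
          (sym (only-t (center-leaf lq) q≢v (leaf-leaf lv lq))))
  claw-omits-twin u-v N[v]⊆N[u] only-t (inj₂ lu) (inj₁ refl) with other-leaves lu
  ... | p , _ , lp , _ , _ , p≢u , _ with N[v]⊆N[u] (center-leaf lp)
  ...   | inj₁ u≡p = p≢u (sym u≡p)
  ...   | inj₂ u-p = leaf-leaf lu lp u-p

InducedOn : ∀ {k l} → Graph k → Graph l → (Fin k → Fin l) → (Fin k → Set) → Set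
InducedOn H K r S = ∀ {u v} → S u → S v → u ≢ v → r u ≢ r v × (E H u v ⇔ E K (r u) (r v))

claw-reflect : ∀ {k l} {H : Graph k} {K : Graph l} {r : Fin k → Fin l} {c x y z} →
  ClawFree K → InducedOn H K r (InClaw c x y z) → ¬ Claw H c x y z
claw-reflect {H = H} {K} {r} {c} {x} {y} {z} clawFree induced claw =
  clawFree (r c) (r x) (r y) (r z)
    (edge c∈ x∈ c-x) (edge c∈ y∈ c-y) (edge c∈ z∈ c-z)
    (proj₁ (induced x∈ y∈ x≢y)) (proj₁ (induced x∈ z∈ x≢z)) (proj₁ (induced y∈ z∈ y≢z))
    (non-edge x∈ y∈ x≢y ¬x-y , non-edge x∈ z∈ x≢z ¬x-z , non-edge y∈ z∈ y≢z ¬y-z)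
  where
  open Claw claw
  c∈ : InClaw c x y z c
  c∈ = inj₁ refl
  x∈ : InClaw c x y z x
  x∈ = inj₂ (inj₁ refl)
  y∈ : InClaw c x y z y
  y∈ = inj₂ (inj₂ (inj₁ refl))
  z∈ : InClaw c x y z z
  z∈ = inj₂ (inj₂ (inj₂ refl))
  edge : ∀ {u v} → InClaw c x y z u → InClaw c x y z v → E H u v → E K (r u) (r v)
  edge u∈ v∈ e = to (proj₂ (induced u∈ v∈ λ { refl → E-irrefl H e })) e
  non-edge : ∀ {u v} → InClaw c x y z u → InClaw c x y z v → u ≢ v → ¬ E H u v → ¬ E K (r u) (r v)
  non-edge u∈ v∈ u≢v ¬e = ¬e ∘ from (proj₂ (induced u∈ v∈ u≢v))

module _ {n} {G : Graph n} {A B : Subset n} (W : WJoin G A B) where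
  open WJoin W

  wjoin-edge : ∃₂ λ x y → x ∈ A × y ∈ B × E G x y
  wjoin-edge with any? (λ x → (x ∈? A) ×-dec any? (λ y → (y ∈? B) ×-dec E? G x y))
  ... | yes (x , x∈A , y , y∈B , x-y) = x , y , x∈A , y∈B , x-y
  ... | no ∄ = ⊥-elim (notAnti λ x y x∈A y∈B x-y → ∄ (x , x∈A , y , y∈B , x-y))

  wjoin-non-edge : ∃₂ λ x y → x ∈ A × y ∈ B × ¬ E G x y
  wjoin-non-edge with any? (λ x → (x ∈? A) ×-dec any? (λ y → (y ∈? B) ×-dec ¬? (E? G x y)))
  ... | yes (x , x∈A , y , y∈B , ¬x-y) = x , y , x∈A , y∈B , ¬x-y
  ... | no ∄ = ⊥-elim (notCompl complete)
    where
    complete : ∀ x y → x ∈ A → y ∈ B → E G x y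
    complete x y x∈A y∈B with E? G x y
    ... | yes x-y = x-y
    ... | no ¬x-y = ⊥-elim (∄ (x , x∈A , y , y∈B , ¬x-y))

∉∪-comm : ∀ {k} {u : Fin k} {A B : Subset k} → u ∉ A ∪ B → u ∉ B ∪ A
∉∪-comm {A = A} {B} = subst (_ ∉_) (∪-comm A B)

module _ {n} {G : Graph n} {A B : Subset n} where

  properWJoin-swap : ProperWJoin G A B → ProperWJoin G B A
  properWJoin-swap P = record
    { wjoin = record
      { disjoint = λ v v∈B v∈A → disjoint v v∈A v∈B
      ; cliqueA  = cliqueB
      ; cliqueB  = cliqueA
      ; homogA   = λ v v∉ → homogB v (∉∪-comm v∉)
      ; homogB   = λ v v∉ → homogA v (∉∪-comm v∉)
      ; notCompl = λ all → notCompl λ u v u∈A v∈B → E-sym G (all v u v∈B u∈A)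
      ; notAnti  = λ none → notAnti λ u v u∈A v∈B → none v u v∈B u∈A ∘ E-sym G
      ; size     = swap size
      }
    ; properA = properB
    ; properB = properA
    }
    where
    open ProperWJoin P
    open WJoin wjoin

  module _ {m} {G′ : Graph m} {f : Fin n → Fin m} {a a′ b b′ : Fin m} where

    isWJoinReduct-swap : IsWJoinReduct G A B G′ f a a′ b b′ → IsWJoinReduct G B A G′ f b b′ a a′
    isWJoinReduct-swap R = record
      { f-inj        = λ u v u∉ v∉ → f-inj u v (∉∪-comm u∉) (∉∪-comm v∉)
      ; f-fresh      = λ u u∉ → fresh (f-fresh u (∉∪-comm u∉))
      ; new-distinct = distinct new-distinct
      ; covers       = cover ∘ covers
      ; adj-old      = λ u v u∉ v∉ → adj-old u v (∉∪-comm u∉) (∉∪-comm v∉)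
      ; adj-a        = λ u u∉ → adj-b u (∉∪-comm u∉)
      ; adj-a'       = λ u u∉ → adj-b' u (∉∪-comm u∉)
      ; adj-b        = λ u u∉ → adj-a u (∉∪-comm u∉)
      ; adj-b'       = λ u u∉ → adj-a' u (∉∪-comm u∉)
      ; aa'          = bb'
      ; bb'          = aa'
      ; ab           = E-sym G′ ab
      ; ¬ab'         = ¬a'b ∘ E-sym G′
      ; ¬a'b         = ¬ab' ∘ E-sym G′
      ; ¬a'b'        = ¬a'b' ∘ E-sym G′
      }
      where
      open IsWJoinReduct R
      fresh : ∀ {w} → w ≢ a × w ≢ a′ × w ≢ b × w ≢ b′ → w ≢ b × w ≢ b′ × w ≢ a × w ≢ a′
      fresh (≢a , ≢a′ , ≢b , ≢b′) = ≢b , ≢b′ , ≢a , ≢a′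
      distinct : a ≢ a′ × a ≢ b × a ≢ b′ × a′ ≢ b × a′ ≢ b′ × b ≢ b′ →
                 b ≢ b′ × b ≢ a × b ≢ a′ × b′ ≢ a × b′ ≢ a′ × a ≢ a′
      distinct (a≢a′ , a≢b , a≢b′ , a′≢b , a′≢b′ , b≢b′) =
        b≢b′ , a≢b ∘ sym , a′≢b ∘ sym , a≢b′ ∘ sym , a′≢b′ ∘ sym , a≢a′
      cover : ∀ {w} → (Σ _ λ u → u ∉ A ∪ B × f u ≡ w) ⊎ w ≡ a ⊎ w ≡ a′ ⊎ w ≡ b ⊎ w ≡ b′ →
                      (Σ _ λ u → u ∉ B ∪ A × f u ≡ w) ⊎ w ≡ b ⊎ w ≡ b′ ⊎ w ≡ a ⊎ w ≡ a′
      cover (inj₁ (u , u∉ , fu≡w))          = inj₁ (u , ∉∪-comm u∉ , fu≡w)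
      cover (inj₂ (inj₁ w≡a))               = inj₂ (inj₂ (inj₂ (inj₁ w≡a)))
      cover (inj₂ (inj₂ (inj₁ w≡a′)))        = inj₂ (inj₂ (inj₂ (inj₂ w≡a′)))
      cover (inj₂ (inj₂ (inj₂ (inj₁ w≡b))))  = inj₂ (inj₁ w≡b)
      cover (inj₂ (inj₂ (inj₂ (inj₂ w≡b′)))) = inj₂ (inj₂ (inj₁ w≡b′))

-- Only the side A and its new vertices a, a′ are treated here; the side B is handled by
-- instantiating the module with the swapped W-join.
module JoinSide {n m} {G : Graph n} {A B : Subset n} {G′ : Graph m} {f : Fin n → Fin m}
  {a a′ b b′ : Fin m}
  (P : ProperWJoin G A B) (R : IsWJoinReduct G A B G′ f a a′ b b′) where
  open ProperWJoin P
  open WJoin wjoin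
  open IsWJoinReduct R

  Old : Fin n → Set
  Old u = u ∉ A ∪ B

  old : ∀ {u} → u ∉ A → u ∉ B → Old u
  old u∉A u∉B u∈A∪B with x∈p∪q⁻ A B u∈A∪B
  ... | inj₁ u∈A = u∉A u∈A
  ... | inj₂ u∈B = u∉B u∈B

  old∉A : ∀ {u} → Old u → u ∉ A
  old∉A u∉ = u∉ ∘ x∈p∪q⁺ ∘ inj₁

  AdjToA : Fin n → Set
  AdjToA u = Σ _ λ x → x ∈ A × E G x u

  New : Fin m → Set
  New w = w ≡ a ⊎ w ≡ a′

  new-fresh : ∀ {u} → Old u → ¬ New (f u)
  new-fresh u∉ (inj₁ fu≡a)  = proj₁ (f-fresh _ u∉) fu≡a
  new-fresh u∉ (inj₂ fu≡a′) = proj₁ (proj₂ (f-fresh _ u∉)) fu≡a′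

  new-disjoint : ∀ {w} → New w → ¬ (w ≡ b ⊎ w ≡ b′)
  new-disjoint {w} w-new w-new′ = distinct w-new w-new′ new-distinct
    where
    distinct : New w → w ≡ b ⊎ w ≡ b′ → a ≢ a′ × a ≢ b × a ≢ b′ × a′ ≢ b × a′ ≢ b′ × b ≢ b′ → ⊥
    distinct (inj₁ refl) (inj₁ a≡b)  (_ , a≢b , _)              = a≢b a≡b
    distinct (inj₁ refl) (inj₂ a≡b′) (_ , _ , a≢b′ , _)         = a≢b′ a≡b′
    distinct (inj₂ refl) (inj₁ a′≡b)  (_ , _ , _ , a′≢b , _)     = a′≢b a′≡b
    distinct (inj₂ refl) (inj₂ a′≡b′) (_ , _ , _ , _ , a′≢b′ , _) = a′≢b′ a′≡b′

  new-new-edge : ∀ {w w′} → New w → w′ ≡ b ⊎ w′ ≡ b′ → E G′ w w′ → w ≡ a × w′ ≡ b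
  new-new-edge (inj₁ refl) (inj₁ refl) _    = refl , refl
  new-new-edge (inj₁ refl) (inj₂ refl) a-b′  = ⊥-elim (¬ab' a-b′)
  new-new-edge (inj₂ refl) (inj₁ refl) a′-b  = ⊥-elim (¬a'b a′-b)
  new-new-edge (inj₂ refl) (inj₂ refl) a′-b′ = ⊥-elim (¬a'b' a′-b′)

  a-near-new : ∀ {w} → New w → Near G′ a w
  a-near-new (inj₁ refl) = inj₁ refl
  a-near-new (inj₂ refl) = inj₂ aa'

  adjToA-complete : ∀ {u x} → Old u → AdjToA u → x ∈ A → E G x u
  adjToA-complete {u} u∉ (x′ , x′∈A , x′-u) x∈A with homogA u u∉
  ... | inj₁ u⇒A = E-sym G (u⇒A _ x∈A)
  ... | inj₂ u⇏A = ⊥-elim (u⇏A x′ x′∈A (E-sym G x′-u))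

  new-old : ∀ {w u} → New w → (u∉ : Old u) → E G′ w (f u) ⇔ AdjToA u
  new-old (inj₁ refl) u∉ = adj-a _ u∉
  new-old (inj₂ refl) u∉ = adj-a' _ u∉

  new-old-adj : ∀ {w u x} → New w → Old u → x ∈ A → E G′ w (f u) ⇔ E G x u
  new-old-adj w-new u∉ x∈A = mk⇔
    (λ w-fu → adjToA-complete u∉ (to (new-old w-new u∉) w-fu) x∈A)
    (λ x-u → from (new-old w-new u∉) (_ , x∈A , x-u))

  nbrs-a′ : ∀ {w} → E G′ a′ w → w ≡ a ⊎ Σ _ λ u → Old u × f u ≡ w × AdjToA u
  nbrs-a′ {w} a′-w with covers w
  ... | inj₁ (u , u∉ , refl)         = inj₂ (u , u∉ , refl , to (adj-a' u u∉) a′-w)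
  ... | inj₂ (inj₁ refl)             = inj₁ refl
  ... | inj₂ (inj₂ (inj₁ refl))      = ⊥-elim (E-irrefl G′ a′-w)
  ... | inj₂ (inj₂ (inj₂ (inj₁ refl))) = ⊥-elim (¬a'b a′-w)
  ... | inj₂ (inj₂ (inj₂ (inj₂ refl))) = ⊥-elim (¬a'b' a′-w)

  nbrs-a : ∀ {w} → E G′ a w → w ≡ a′ ⊎ w ≡ b ⊎ Σ _ λ u → Old u × f u ≡ w × AdjToA u
  nbrs-a {w} a-w with covers w
  ... | inj₁ (u , u∉ , refl)         = inj₂ (inj₂ (u , u∉ , refl , to (adj-a u u∉) a-w))
  ... | inj₂ (inj₁ refl)             = ⊥-elim (E-irrefl G′ a-w)
  ... | inj₂ (inj₂ (inj₁ refl))      = inj₁ refl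
  ... | inj₂ (inj₂ (inj₂ (inj₁ refl))) = inj₂ (inj₁ refl)
  ... | inj₂ (inj₂ (inj₂ (inj₂ refl))) = ⊥-elim (¬ab' a-w)

  claw-has-one-new : ∀ {c x y z w w′} → Claw G′ c x y z →
    InClaw c x y z w → InClaw c x y z w′ → New w → New w′ → w ≡ w′
  claw-has-one-new claw w∈ w′∈ (inj₁ refl) (inj₁ refl) = refl
  claw-has-one-new claw w∈ w′∈ (inj₂ refl) (inj₂ refl) = refl
  claw-has-one-new claw w∈ w′∈ (inj₁ refl) (inj₂ refl) =
    ⊥-elim (claw-omits-twin claw aa' N[a′]⊆N[a] only-b w∈ w′∈)
    where
    N[a′]⊆N[a] : ∀ {v} → E G′ a′ v → Near G′ a v
    N[a′]⊆N[a] a′-v with nbrs-a′ a′-v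
    ... | inj₁ refl                   = inj₁ refl
    ... | inj₂ (u , u∉ , refl , adjA) = inj₂ (from (adj-a u u∉) adjA)
    only-b : ∀ {v} → E G′ a v → v ≢ a′ → ¬ E G′ a′ v → v ≡ b
    only-b a-v v≢a′ ¬a′-v with nbrs-a a-v
    ... | inj₁ refl                          = ⊥-elim (v≢a′ refl)
    ... | inj₂ (inj₁ refl)                   = refl
    ... | inj₂ (inj₂ (u , u∉ , refl , adjA)) = ⊥-elim (¬a′-v (from (adj-a' u u∉) adjA))
  claw-has-one-new claw w∈ w′∈ (inj₂ refl) (inj₁ refl) =
    sym (claw-has-one-new claw w′∈ w∈ (inj₁ refl) (inj₂ refl))

  A-dominated : ∀ {D r x₀} → Dominating G′ D → x₀ ∈ A → (∀ {w} → New w → r w ≡ x₀) →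
    (∀ {u} → Old u → r (f u) ≡ u) → ∀ {v} → v ∈ A → Dominated G (img r D) v
  A-dominated {D} {r} dom x₀∈A r-new r-old {v} v∈A with dominator G′ (dom a′)
  ... | w , w∈D , w-near-a′ = dominated G (img⁺ r w∈D) (near w-near-a′)
    where
    new-near : ∀ {w} → New w → Near G (r w) v
    new-near w-new rewrite r-new w-new = clique-near G cliqueA x₀∈A v∈A
    near : Near G′ w a′ → Near G (r w) v
    near (inj₁ refl) = new-near (inj₂ refl)
    near (inj₂ w-a′) with nbrs-a′ (E-sym G′ w-a′)
    ... | inj₁ refl                   = new-near (inj₁ refl)
    ... | inj₂ (u , u∉ , refl , adjA) rewrite r-old u∉ = inj₂ (E-sym G (adjToA-complete u∉ adjA v∈A))

  MeetsA : Subset n → Set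
  MeetsA D = Σ _ λ u → u ∈ D × u ∉ B × Σ _ λ x → x ∈ A × Near G u x

  meetsA? : ∀ D → Dec (MeetsA D)
  meetsA? D = any? λ u → (u ∈? D) ×-dec ¬? (u ∈? B) ×-dec any? (λ x → (x ∈? A) ×-dec near? G u x)

  new-dominated : ∀ {D h} → MeetsA D → (∀ {u} → u ∈ A → h u ≡ a) → (∀ {u} → Old u → h u ≡ f u) →
    ∀ {w} → New w → Dominated G′ (img h D) w
  new-dominated {D} {h} (u , u∈D , u∉B , x , x∈A , u-near-x) h-A h-old {w} w-new =
    dominated G′ (img⁺ h u∈D) hu-near-w
    where
    old-near : u ∉ A → Near G u x → Near G′ (h u) w
    old-near u∉A (inj₁ u≡x) = ⊥-elim (u∉A (subst (_∈ A) (sym u≡x) x∈A))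
    old-near u∉A (inj₂ u-x) rewrite h-old (old u∉A u∉B) =
      inj₂ (E-sym G′ (from (new-old w-new (old u∉A u∉B)) (x , x∈A , E-sym G u-x)))
    hu-near-w : Near G′ (h u) w
    hu-near-w with u ∈? A
    ... | yes u∈A rewrite h-A u∈A = a-near-new w-new
    ... | no u∉A = old-near u∉A u-near-x

  meets : ∀ {D u} → u ∈ D → u ∈ A → MeetsA D
  meets u∈D u∈A = _ , u∈D , disjoint _ u∈A , _ , u∈A , inj₁ refl

  dominator-in-B : ∀ {D u x} → ¬ MeetsA D → u ∈ D → x ∈ A → Near G u x → u ∈ B
  dominator-in-B {u = u} misses u∈D x∈A u-near-x with u ∈? B
  ... | yes u∈B = u∈B
  ... | no u∉B  = ⊥-elim (misses (u , u∈D , u∉B , _ , x∈A , u-near-x))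

  -- by properness the vertex y ∈ D ∩ B dominating A misses some x ∈ A, which needs a second one
  two-in-B : ∀ {D} → Dominating G D → ¬ MeetsA D → ∃₂ λ s y → s ∈ D × y ∈ D × s ∈ B × y ∈ B × s ≢ y
  two-in-B {D} dom misses with wjoin-edge wjoin
  ... | x₀ , _ , x₀∈A , _ with dominator G (dom x₀)
  ...   | y , y∈D , y-near-x₀ with dominator-in-B misses y∈D x₀∈A y-near-x₀
  ...     | y∈B with not-complete G (proj₁ (properB y y∈B))
  ...       | x , x∈A , ¬y-x with dominator G (dom x)
  ...         | s , s∈D , s-near-x =
    s , y , s∈D , y∈D , dominator-in-B misses s∈D x∈A s-near-x , y∈B ,
    λ { refl → ¬near G (λ { refl → disjoint s x∈A y∈B }) ¬y-x s-near-x }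

module Reduction {n m} {G : Graph n} {A B : Subset n} {G′ : Graph m} {f : Fin n → Fin m}
  {a a′ b b′ : Fin m}
  (P : ProperWJoin G A B) (R : IsWJoinReduct G A B G′ f a a′ b b′) where
  open ProperWJoin P
  open WJoin wjoin
  open IsWJoinReduct R
  module SA = JoinSide P R
  module SB = JoinSide (properWJoin-swap P) (isWJoinReduct-swap R)
  open SA using (Old; old; old∉A)

  old∉B : ∀ {u} → Old u → u ∉ B
  old∉B = SB.old∉A ∘ ∉∪-comm

  data Kind (w : Fin m) : Set where
    old′  : ∀ u → Old u → f u ≡ w → Kind w
    new-a : SA.New w → Kind w
    new-b : SB.New w → Kind w

  kind : ∀ w → Kind w
  kind w with covers w
  ... | inj₁ (u , u∉ , fu≡w)          = old′ u u∉ fu≡w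
  ... | inj₂ (inj₁ w≡a)               = new-a (inj₁ w≡a)
  ... | inj₂ (inj₂ (inj₁ w≡a′))        = new-a (inj₂ w≡a′)
  ... | inj₂ (inj₂ (inj₂ (inj₁ w≡b)))  = new-b (inj₁ w≡b)
  ... | inj₂ (inj₂ (inj₂ (inj₂ w≡b′))) = new-b (inj₂ w≡b′)

  rep : Fin n → Fin n → Fin m → Fin n
  rep x₀ y₀ w with kind w
  ... | old′ u _ _ = u
  ... | new-a _    = x₀
  ... | new-b _    = y₀

  module _ {x₀ y₀ : Fin n} where

    rep-old : ∀ {u} → Old u → rep x₀ y₀ (f u) ≡ u
    rep-old {u} u∉ with kind (f u)
    ... | old′ u′ u′∉ fu′≡fu = f-inj u′ u u′∉ u∉ fu′≡fu
    ... | new-a fu-new      = ⊥-elim (SA.new-fresh u∉ fu-new)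
    ... | new-b fu-new      = ⊥-elim (SB.new-fresh (∉∪-comm u∉) fu-new)

    rep-a : ∀ {w} → SA.New w → rep x₀ y₀ w ≡ x₀
    rep-a {w} w-new with kind w
    ... | old′ u u∉ refl = ⊥-elim (SA.new-fresh u∉ w-new)
    ... | new-a _        = refl
    ... | new-b w-new′   = ⊥-elim (SA.new-disjoint w-new w-new′)

    rep-b : ∀ {w} → SB.New w → rep x₀ y₀ w ≡ y₀
    rep-b {w} w-new with kind w
    ... | old′ u u∉ refl = ⊥-elim (SB.new-fresh (∉∪-comm u∉) w-new)
    ... | new-a w-new′   = ⊥-elim (SB.new-disjoint w-new w-new′)
    ... | new-b _        = refl

  b-old-adj : ∀ {w u y} → SB.New w → Old u → y ∈ B → E G′ w (f u) ⇔ E G y u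
  b-old-adj w-new u∉ = SB.new-old-adj w-new (∉∪-comm u∉)

  rep-weakHom : ∀ {x₀ y₀} → x₀ ∈ A → y₀ ∈ B → E G x₀ y₀ → WeakHom G′ G (rep x₀ y₀)
  rep-weakHom {x₀} {y₀} x₀∈A y₀∈B x₀-y₀ {w} {w′} e with kind w | kind w′
  ... | old′ u u∉ refl | old′ v v∉ refl = inj₂ (trans (sym (adj-old u v u∉ v∉)) e)
  ... | old′ u u∉ refl | new-a w′-new   = inj₂ (E-sym G (to (SA.new-old-adj w′-new u∉ x₀∈A) (E-sym G′ e)))
  ... | old′ u u∉ refl | new-b w′-new   = inj₂ (E-sym G (to (b-old-adj w′-new u∉ y₀∈B) (E-sym G′ e)))
  ... | new-a w-new    | old′ v v∉ refl = inj₂ (to (SA.new-old-adj w-new v∉ x₀∈A) e)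
  ... | new-a _        | new-a _        = inj₁ refl
  ... | new-a _        | new-b _        = inj₂ x₀-y₀
  ... | new-b w-new    | old′ v v∉ refl = inj₂ (to (b-old-adj w-new v∉ y₀∈B) e)
  ... | new-b _        | new-a _        = inj₂ (E-sym G x₀-y₀)
  ... | new-b _        | new-b _        = inj₁ refl

  AtMostOne : (Fin m → Set) → (Fin m → Set) → Set
  AtMostOne New S = ∀ {w w′} → S w → S w′ → New w → New w′ → w ≡ w′

  -- if S contains at most one new vertex per side, rep is faithful on S provided the
  -- chosen x₀ y₀ are adjacent exactly when S contains the (only adjacent) pair a, b
  module _ {x₀ y₀ : Fin n} {S : Fin m → Set} (x₀∈A : x₀ ∈ A) (y₀∈B : y₀ ∈ B)
    (one-a : AtMostOne SA.New S) (one-b : AtMostOne SB.New S)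
    (x₀-y₀⇒ : E G x₀ y₀ → S a × S b) (⇒x₀-y₀ : S a → S b → E G x₀ y₀) where

    private
      flip-pair : ∀ {w w′ u v} → u ≢ v × (E G′ w w′ ⇔ E G u v) → v ≢ u × (E G′ w′ w ⇔ E G v u)
      flip-pair (u≢v , w-w′⇔u-v) =
        u≢v ∘ sym , mk⇔ (E-sym G ∘ to w-w′⇔u-v ∘ E-sym G′) (E-sym G′ ∘ from w-w′⇔u-v ∘ E-sym G)

      a-old : ∀ {w u} → SA.New w → Old u → x₀ ≢ u × (E G′ w (f u) ⇔ E G x₀ u)
      a-old w-new u∉ = (λ { refl → old∉A u∉ x₀∈A }) , SA.new-old-adj w-new u∉ x₀∈A

      b-old : ∀ {w u} → SB.New w → Old u → y₀ ≢ u × (E G′ w (f u) ⇔ E G y₀ u)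
      b-old w-new u∉ = (λ { refl → old∉B u∉ y₀∈B }) , b-old-adj w-new u∉ y₀∈B

      across : ∀ {w w′} → S w → S w′ → SA.New w → SB.New w′ → x₀ ≢ y₀ × (E G′ w w′ ⇔ E G x₀ y₀)
      across {w} {w′} w∈ w′∈ w-new w′-new = (λ { refl → disjoint x₀ x₀∈A y₀∈B }) , mk⇔ ⇒ ⇐
        where
        ⇒ : E G′ w w′ → E G x₀ y₀
        ⇒ e with SA.new-new-edge w-new w′-new e
        ... | refl , refl = ⇒x₀-y₀ w∈ w′∈
        ⇐ : E G x₀ y₀ → E G′ w w′
        ⇐ e with x₀-y₀⇒ e
        ... | a∈ , b∈ rewrite one-a w∈ a∈ w-new (inj₁ refl) | one-b w′∈ b∈ w′-new (inj₁ refl) = ab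

    rep-induced : InducedOn G′ G (rep x₀ y₀) S
    rep-induced {w} {w′} w∈ w′∈ w≢w′ with kind w | kind w′
    ... | old′ u u∉ refl | old′ v v∉ refl =
      w≢w′ ∘ cong f , mk⇔ (trans (sym (adj-old u v u∉ v∉))) (trans (adj-old u v u∉ v∉))
    ... | old′ u u∉ refl | new-a w′-new   = flip-pair (a-old w′-new u∉)
    ... | old′ u u∉ refl | new-b w′-new   = flip-pair (b-old w′-new u∉)
    ... | new-a w-new    | old′ v v∉ refl = a-old w-new v∉
    ... | new-a w-new    | new-a w′-new   = ⊥-elim (w≢w′ (one-a w∈ w′∈ w-new w′-new))
    ... | new-a w-new    | new-b w′-new   = across w∈ w′∈ w-new w′-new
    ... | new-b w-new    | old′ v v∉ refl = b-old w-new v∉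
    ... | new-b w-new    | new-a w′-new   = flip-pair (across w′∈ w∈ w′-new w-new)
    ... | new-b w-new    | new-b w′-new   = ⊥-elim (w≢w′ (one-b w∈ w′∈ w-new w′-new))

  clawFree : ClawFree G → ClawFree G′
  clawFree clawFree-G c x y z c-x c-y c-z x≢y x≢z y≢z (¬x-y , ¬x-z , ¬y-z) =
    reflect (InClaw? c x y z a ×-dec InClaw? c x y z b)
    where
    claw : Claw G′ c x y z
    claw = record { c-x = c-x ; c-y = c-y ; c-z = c-z ; x≢y = x≢y ; x≢z = x≢z ; y≢z = y≢z
                  ; ¬x-y = ¬x-y ; ¬x-z = ¬x-z ; ¬y-z = ¬y-z }
    via : ∀ {x₀ y₀} → x₀ ∈ A → y₀ ∈ B → (E G x₀ y₀ → InClaw c x y z a × InClaw c x y z b) →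
      (InClaw c x y z a → InClaw c x y z b → E G x₀ y₀) → ⊥
    via {x₀} {y₀} x₀∈A y₀∈B ⇒ ⇐ = claw-reflect {K = G} {r = rep x₀ y₀} clawFree-G
      (rep-induced x₀∈A y₀∈B (SA.claw-has-one-new claw) (SB.claw-has-one-new claw) ⇒ ⇐) claw
    reflect : Dec (InClaw c x y z a × InClaw c x y z b) → ⊥
    reflect (yes (a∈ , b∈)) with wjoin-edge wjoin
    ... | _ , _ , x₀∈A , y₀∈B , x₀-y₀ = via x₀∈A y₀∈B (λ _ → a∈ , b∈) (λ _ _ → x₀-y₀)
    reflect (no ¬both) with wjoin-non-edge wjoin
    ... | _ , _ , x₀∈A , y₀∈B , ¬x₀-y₀ =
      via x₀∈A y₀∈B (⊥-elim ∘ ¬x₀-y₀) (λ a∈ b∈ → ⊥-elim (¬both (a∈ , b∈)))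

  data Part (u : Fin n) : Set where
    inA : u ∈ A → Part u
    inB : u ∈ B → Part u
    out : Old u → Part u

  part : ∀ u → Part u
  part u with u ∈? A | u ∈? B
  ... | yes u∈A | _       = inA u∈A
  ... | no _    | yes u∈B = inB u∈B
  ... | no u∉A  | no u∉B  = out (old u∉A u∉B)

  shrink-to-G : ShrinksCDS G′ G
  shrink-to-G D (dom , conn) with wjoin-edge wjoin
  ... | x₀ , y₀ , x₀∈A , y₀∈B , x₀-y₀ =
    img r D , (dom-G , connectedOn-img hom conn) , ∣img∣≤ r D
    where
    r : Fin m → Fin n
    r = rep x₀ y₀
    hom : WeakHom G′ G r
    hom = rep-weakHom x₀∈A y₀∈B x₀-y₀
    dom-G : Dominating G (img r D)
    dom-G v with part v
    ... | inA v∈A = SA.A-dominated dom x₀∈A rep-a rep-old v∈A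
    ... | inB v∈B = SB.A-dominated dom y₀∈B rep-b (rep-old ∘ ∉∪-comm) v∈B
    ... | out v∉  =
      subst (Dominated G (img r D)) (rep-old v∉) (dominated-img {H = G′} {K = G} hom (dom (f v)))

  collapse : Fin n → Fin m
  collapse u with part u
  ... | inA _ = a
  ... | inB _ = b
  ... | out _ = f u

  collapse-A : ∀ {u} → u ∈ A → collapse u ≡ a
  collapse-A {u} u∈A with part u
  ... | inA _   = refl
  ... | inB u∈B = ⊥-elim (disjoint u u∈A u∈B)
  ... | out u∉  = ⊥-elim (old∉A u∉ u∈A)

  collapse-B : ∀ {u} → u ∈ B → collapse u ≡ b
  collapse-B {u} u∈B with part u
  ... | inA u∈A = ⊥-elim (disjoint u u∈A u∈B)
  ... | inB _   = refl
  ... | out u∉  = ⊥-elim (old∉B u∉ u∈B)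

  collapse-old : ∀ {u} → Old u → collapse u ≡ f u
  collapse-old {u} u∉ with part u
  ... | inA u∈A = ⊥-elim (old∉A u∉ u∈A)
  ... | inB u∈B = ⊥-elim (old∉B u∉ u∈B)
  ... | out _   = refl

  collapse-weakHom : WeakHom G G′ collapse
  collapse-weakHom {u} {v} e with part u | part v
  ... | inA _   | inA _   = inj₁ refl
  ... | inA _   | inB _   = inj₂ ab
  ... | inA u∈A | out v∉  = inj₂ (from (SA.new-old-adj (inj₁ refl) v∉ u∈A) e)
  ... | inB _   | inA _   = inj₂ (E-sym G′ ab)
  ... | inB _   | inB _   = inj₁ refl
  ... | inB u∈B | out v∉  = inj₂ (from (b-old-adj (inj₁ refl) v∉ u∈B) e)
  ... | out u∉  | inA v∈A = inj₂ (E-sym G′ (from (SA.new-old-adj (inj₁ refl) u∉ v∈A) (E-sym G e)))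
  ... | out u∉  | inB v∈B = inj₂ (E-sym G′ (from (b-old-adj (inj₁ refl) u∉ v∈B) (E-sym G e)))
  ... | out u∉  | out v∉  = inj₂ (trans (adj-old u v u∉ v∉) e)

  -- the image of D, plus the vertices X standing in for a side that D does not reach
  collapse-cds : ∀ {D X} → ConnDominating G D → (SA.MeetsA D ⊎ a ∈ X) → (SB.MeetsA D ⊎ b ∈ X) →
    (∀ {w} → w ∈ X → ∃ λ u → u ∈ D × Near G′ (collapse u) w) → ConnDominating G′ (img collapse D ∪ X)
  collapse-cds {D} {X} (dom , conn) side-a side-b anchor-X =
    dom′ , connectedOn-anchored collapse-weakHom conn (img⊆ ∘ img⁺ collapse) anchor
    where
    img⊆ : img collapse D ⊆ img collapse D ∪ X
    img⊆ = x∈p∪q⁺ ∘ inj₁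
    X⊆ : X ⊆ img collapse D ∪ X
    X⊆ = x∈p∪q⁺ ∘ inj₂
    anchor : ∀ {w} → w ∈ img collapse D ∪ X → ∃ λ u → u ∈ D × Near G′ (collapse u) w
    anchor w∈ with x∈p∪q⁻ (img collapse D) X w∈
    ... | inj₂ w∈X = anchor-X w∈X
    ... | inj₁ w∈img with img⁻ collapse w∈img
    ...   | u , u∈D , refl = u , u∈D , inj₁ refl
    new-a-dominated : ∀ {w} → SA.MeetsA D ⊎ a ∈ X → SA.New w → Dominated G′ (img collapse D ∪ X) w
    new-a-dominated (inj₁ meets) w-new =
      dominated-⊆ G′ img⊆ (SA.new-dominated meets collapse-A collapse-old w-new)
    new-a-dominated (inj₂ a∈X) w-new = dominated G′ (X⊆ a∈X) (SA.a-near-new w-new)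
    new-b-dominated : ∀ {w} → SB.MeetsA D ⊎ b ∈ X → SB.New w → Dominated G′ (img collapse D ∪ X) w
    new-b-dominated (inj₁ meets) w-new =
      dominated-⊆ G′ img⊆ (SB.new-dominated meets collapse-B (collapse-old ∘ ∉∪-comm) w-new)
    new-b-dominated (inj₂ b∈X) w-new = dominated G′ (X⊆ b∈X) (SB.a-near-new w-new)
    dom′ : Dominating G′ (img collapse D ∪ X)
    dom′ w with kind w
    ... | old′ u u∉ refl = dominated-⊆ G′ img⊆ (subst (Dominated G′ (img collapse D)) (collapse-old u∉)
                             (dominated-img {H = G} {K = G′} collapse-weakHom (dom u)))
    ... | new-a w-new    = new-a-dominated side-a w-new
    ... | new-b w-new    = new-b-dominated side-b w-new

  collapse-cds-single : ∀ {D t u} → ConnDominating G D → (SA.MeetsA D ⊎ a ≡ t) → (SB.MeetsA D ⊎ b ≡ t) →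
    u ∈ D → Near G′ (collapse u) t → ConnDominating G′ (img collapse D ∪ ⁅ t ⁆)
  collapse-cds-single {t = t} {u} cds side-a side-b u∈D u-near-t = collapse-cds cds
    (map₂ (λ { refl → x∈⁅x⁆ t }) side-a) (map₂ (λ { refl → x∈⁅x⁆ t }) side-b)
    (λ w∈ → u , u∈D , subst (Near G′ (collapse u)) (sym (x∈⁅y⁆⇒x≡y t w∈)) u-near-t)

  shrink-to-G′ : ShrinksCDS G G′
  shrink-to-G′ D cds@(dom , _) with SA.meetsA? D | SB.meetsA? D
  ... | yes meets-a | yes meets-b =
    img collapse D ∪ ∅ , collapse-cds cds (inj₁ meets-a) (inj₁ meets-b) (⊥-elim ∘ ∉⊥) ,
    subst (λ S → ∣ S ∣ ≤ ∣ D ∣) (sym (∪-identityʳ (img collapse D))) (∣img∣≤ collapse D)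
  ... | no misses-a | _ with SA.two-in-B dom misses-a
  ...   | s , y , s∈D , y∈D , s∈B , y∈B , s≢y =
    img collapse D ∪ ⁅ a ⁆ ,
    collapse-cds-single cds (inj₂ refl) (inj₁ (SB.meets y∈D y∈B))
      y∈D (subst (λ w → Near G′ w a) (sym (collapse-B y∈B)) (inj₂ (E-sym G′ ab))) ,
    ∣img∪⁅⁆∣≤ collapse a s∈D y∈D s≢y (trans (collapse-B s∈B) (sym (collapse-B y∈B)))
  shrink-to-G′ D cds@(dom , _) | yes meets-a | no misses-b with SB.two-in-B dom misses-b
  ...   | s , x , s∈D , x∈D , s∈A , x∈A , s≢x =
    img collapse D ∪ ⁅ b ⁆ ,
    collapse-cds-single cds (inj₁ meets-a) (inj₂ refl)
      x∈D (subst (λ w → Near G′ w b) (sym (collapse-A x∈A)) (inj₂ ab)) ,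
    ∣img∪⁅⁆∣≤ collapse b s∈D x∈D s≢x (trans (collapse-A s∈A) (sym (collapse-A x∈A)))

lemma13 : ∀ {n m} (G : Graph n) (A B : Subset n) (G' : Graph m)
            (f : Fin n → Fin m) (a a' b b' : Fin m) →
            Connected G → ProperWJoin G A B →
            IsWJoinReduct G A B G' f a a' b b' →
            (∀ (k : ℕ) → IsConnDomNumber G k ⇔ IsConnDomNumber G' k)
            × (ClawFree G → ClawFree G')
lemma13 G A B G' f a a' b b' _ P R = isConnDomNumber-⇔ shrink-to-G′ shrink-to-G , clawFree
  where open Reduction P R
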